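{- Let $R$ be a word rewriting system over $\Sigma$ and $(L_R)_D$ the deep inference calculus of its associated strictly positive logic. Let $A,B\in\Sigma^*$ and $p$ a propositional variable. If $Bp$ is derivable from $Ap$ in $(L_R)_D$, then there is a derivation of $Bp$ from $Ap$ in $(L_R)_D$ in which no conjunction rule (neither conjunction introduction nor conjunction elimination) is applied.
   Context: A word rewriting system $R$ over $\Sigma$ is a set of rules $U\mapsto V$ with $U,V\in\Sigma^*$. Strictly positive formulas (letters of $\Sigma$ as diamonds): $A::= p \mid \top \mid (A\land B)\mid aA$, $a\in\Sigma$. For a word $U=a_1\cdots a_n$ and a formula $C$, $UC$ denotes $a_1\cdots a_nC$ (just $C$ if $U$ is empty). The deep inference calculus $(L_R)_D$ has the one-premise rules: from $A$ infer $A\land A$ (conjunction introduction); from $A\land B$ infer $A$ and from $A\land B$ infer $B$ (conjunction elimination); from $A$ infer $\top$ (the $\top$-rule); and, for each rule $U\mapsto V$ of $R$ and each strictly positive formula $C$, from $UC$ infer $VC$. A context is a formula $C(q)$ in which the variable $q$ occurs exactly once; if from $A$ infer $B$ is a rule instance, then $C(B)$ is obtained from $C(A)$ by a rule application. A derivation of $B$ from $A$ is a finite sequence of formulas starting with $A$, ending with $B$, each later member obtained from the previous one by a rule application. -}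

module Defs where

open import Data.Nat using (ℕ)
open import Data.List using (List; []; _∷_)
open import Data.Unit using (⊤)
open import Data.Empty using (⊥)

Var : Set
Var = ℕ

data Form (Σ : Set) : Set where
  var  : Var → Form Σ
  top  : Form Σ
  _∧_  : Form Σ → Form Σ → Form Σ
  ◇    : Σ → Form Σ → Form Σ

RWS : Set → Set₁
RWS Σ = List Σ → List Σ → Set

_·_ : {Σ : Set} → List Σ → Form Σ → Form Σ
[] · C = C
(a ∷ U) · C = ◇ a (U · C)

data RuleKind : Set where
  conjIntro conjElimL conjElimR topRule rewriteRule : RuleKind

data RuleInst {Σ : Set} (R : RWS Σ) : RuleKind → Form Σ → Form Σ → Set where
  ∧I   : ∀ A → RuleInst R conjIntro A (A ∧ A)
  ∧E₁  : ∀ A B → RuleInst R conjElimL (A ∧ B) A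
  ∧E₂  : ∀ A B → RuleInst R conjElimR (A ∧ B) B
  ⊤R   : ∀ A → RuleInst R topRule A top
  rw   : ∀ {U V} → R U V → ∀ C → RuleInst R rewriteRule (U · C) (V · C)

data Ctx (Σ : Set) : Set where
  hole : Ctx Σ
  ∧ₗ   : Ctx Σ → Form Σ → Ctx Σ
  ∧ᵣ   : Form Σ → Ctx Σ → Ctx Σ
  ◇c   : Σ → Ctx Σ → Ctx Σ

plug : {Σ : Set} → Ctx Σ → Form Σ → Form Σ
plug hole A = A
plug (∧ₗ C B) A = plug C A ∧ B
plug (∧ᵣ B C) A = B ∧ plug C A
plug (◇c a C) A = ◇ a (plug C A)

data Step {Σ : Set} (R : RWS Σ) (allowed : RuleKind → Set) : Form Σ → Form Σ → Set where
  apply : ∀ {k A B} → allowed k → (C : Ctx Σ) → RuleInst R k A B →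
          Step R allowed (plug C A) (plug C B)

data Deriv {Σ : Set} (R : RWS Σ) (allowed : RuleKind → Set) : Form Σ → Form Σ → Set where
  done : ∀ {A} → Deriv R allowed A A
  step : ∀ {A B D} → Step R allowed A B → Deriv R allowed B D → Deriv R allowed A D

anyRule : RuleKind → Set
anyRule _ = ⊤

noConj : RuleKind → Set
noConj conjIntro = ⊥
noConj conjElimL = ⊥
noConj conjElimR = ⊥
noConj topRule = ⊤
noConj rewriteRule = ⊤

_⊢[_]_ : {Σ : Set} → Form Σ → RWS Σ → Form Σ → Set
A ⊢[ R ] B = Deriv R anyRule A B

_⊢[_]∧-free_ : {Σ : Set} → Form Σ → RWS Σ → Form Σ → Set
A ⊢[ R ]∧-free B = Deriv R noConj A B

module Submission where

-- A formula built from diamonds, conjunctions, ⊤ and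
-- variables is a tree; a *branch* of F to the variable p is a word W such
-- that reading F from the root along diamonds (choosing either side of each
-- conjunction) reaches p after the letters W.  The formula W p has exactly
-- the branch W.
--
-- Call G *simulated* by F when every branch W of G arises from some branch W'
-- of F with a conjunction-free derivation of W p from W' p.  Every rule
-- instance from A infer B has B simulated by A: conjunction rules and ⊤ only
-- select, duplicate or discard branches, and a rewrite U C ↦ V C turns a
-- branch V W of V C into the branch U W of U C, related by that same rewrite.
-- Simulation is preserved by contexts and composes along derivations, so a
-- derivation of B p from A p yields a branch of A p (necessarily A) with a
-- conjunction-free derivation of B p from it, which is the theorem.

open import Defs
open import Data.List using (List; []; _∷_; _++_)
open import Data.Unit using (tt)
open import Data.Product using (∃; _,_; _×_)
open import Relation.Binary.PropositionalEquality using (_≡_; refl; cong)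

module _ {Σ : Set} where

  ·-++ : (U W : List Σ) (C : Form Σ) → (U ++ W) · C ≡ U · (W · C)
  ·-++ []      W C = refl
  ·-++ (a ∷ U) W C = cong (◇ a) (·-++ U W C)

  module _ {R : RWS Σ} {allowed : RuleKind → Set} where

    _⨾_ : {X Y Z : Form Σ} → Deriv R allowed X Y → Deriv R allowed Y Z →
          Deriv R allowed X Z
    done     ⨾ e = e
    step s d ⨾ e = step s (d ⨾ e)

    ◇-deriv : {X Y : Form Σ} (a : Σ) → Deriv R allowed X Y →
              Deriv R allowed (◇ a X) (◇ a Y)
    ◇-deriv a done                    = done
    ◇-deriv a (step (apply ok C i) d) = step (apply ok (◇c a C) i) (◇-deriv a d)

  data Branch (p : Var) : Form Σ → List Σ → Set where
    here  : Branch p (var p) []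
    left  : {F G : Form Σ} {W : List Σ} → Branch p F W → Branch p (F ∧ G) W
    right : {F G : Form Σ} {W : List Σ} → Branch p G W → Branch p (F ∧ G) W
    under : {a : Σ} {F : Form Σ} {W : List Σ} → Branch p F W →
            Branch p (◇ a F) (a ∷ W)

  prefix-branch : {p : Var} (U : List Σ) {C : Form Σ} {W : List Σ} →
                  Branch p C W → Branch p (U · C) (U ++ W)
  prefix-branch []      b = b
  prefix-branch (a ∷ U) b = under (prefix-branch U b)

  split-branch : {p : Var} (U : List Σ) {C : Form Σ} {W : List Σ} →
                 Branch p (U · C) W → ∃ λ W₁ → (W ≡ U ++ W₁) × Branch p C W₁
  split-branch []      b = _ , refl , b
  split-branch (a ∷ U) (under b) with split-branch U b
  ... | W₁ , refl , b₁ = W₁ , refl , b₁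

  word-branch : {p : Var} (U : List Σ) → Branch p (U · var p) U
  word-branch []      = here
  word-branch (a ∷ U) = under (word-branch U)

  word-branch-unique : {p : Var} (U : List Σ) {W : List Σ} →
                       Branch p (U · var p) W → W ≡ U
  word-branch-unique []      here      = refl
  word-branch-unique (a ∷ U) (under b) = cong (a ∷_) (word-branch-unique U b)

  module _ (R : RWS Σ) (p : Var) where

    _⇝_ : List Σ → List Σ → Set
    W' ⇝ W = (W' · var p) ⊢[ R ]∧-free (W · var p)

    rewrite-⇝ : {U V : List Σ} → R U V → (W : List Σ) → (U ++ W) ⇝ (V ++ W)
    rewrite-⇝ {U} {V} r W
      rewrite ·-++ U W (var p) | ·-++ V W (var p)
      = step (apply tt hole (rw r (W · var p))) done

    Simulated : Form Σ → Form Σ → Set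
    Simulated F G = (W : List Σ) → Branch p G W →
                    ∃ λ W' → Branch p F W' × W' ⇝ W

    instance-simulated : {k : RuleKind} {A B : Form Σ} →
                         RuleInst R k A B → Simulated A B
    instance-simulated (∧I A)    W (left b)  = W , b , done
    instance-simulated (∧I A)    W (right b) = W , b , done
    instance-simulated (∧E₁ A B) W b         = W , left b , done
    instance-simulated (∧E₂ A B) W b         = W , right b , done
    instance-simulated (⊤R A)    W ()
    instance-simulated (rw {U} {V} r C) W b with split-branch V b
    ... | W₁ , refl , b₁ = U ++ W₁ , prefix-branch U b₁ , rewrite-⇝ r W₁

    context-simulated : {A B : Form Σ} (C : Ctx Σ) → Simulated A B →
                        Simulated (plug C A) (plug C B)
    context-simulated hole      sim = sim
    context-simulated (∧ₗ C D) sim W (left b) with context-simulated C sim W b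
    ... | W' , b' , d = W' , left b' , d
    context-simulated (∧ₗ C D) sim W (right b) = W , right b , done
    context-simulated (∧ᵣ D C) sim W (left b)  = W , left b , done
    context-simulated (∧ᵣ D C) sim W (right b) with context-simulated C sim W b
    ... | W' , b' , d = W' , right b' , d
    context-simulated (◇c a C) sim (.a ∷ W) (under b)
      with context-simulated C sim W b
    ... | W' , b' , d = a ∷ W' , under b' , ◇-deriv a d

    derivation-simulated : {F G : Form Σ} → F ⊢[ R ] G → Simulated F G
    derivation-simulated done W b = W , b , done
    derivation-simulated (step (apply _ C i) d) W b
      with derivation-simulated d W b
    ... | W₁ , b₁ , d₁ with context-simulated C (instance-simulated i) W₁ b₁
    ... | W₂ , b₂ , d₂ = W₂ , b₂ , d₂ ⨾ d₁

-- The branch B of B p comes from a branch of A p, which can only be A itself.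
mainTheorem7 : {Σ : Set} (R : RWS Σ) (A B : List Σ) (p : Var) →
    (A · var p) ⊢[ R ] (B · var p) → (A · var p) ⊢[ R ]∧-free (B · var p)
mainTheorem7 R A B p d with derivation-simulated R p d B (word-branch B)
... | W , b , e with word-branch-unique A b
... | refl = e
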